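{- If $T$ is a tree on $n$ vertices, then $\operatorname{xhom}(T,E_2)\le \operatorname{xhom}(P_n,E_2)$, with equality if and only if $T=P_n$.
   Context: $P_n$ is the path on $n$ vertices. $E_2$ is the graph on two vertices, each carrying a loop, with no other edges. For a graph $G$ and a graph $H$ (possibly with loops), a map $\phi:V(G)\to V(H)$ is an existence homomorphism if for every $v\in V(G)$ there is a neighbor $w$ of $v$ in $G$ with $\phi(v)\phi(w)\in E(H)$; $\operatorname{xhom}(G,H)$ is the number of existence homomorphisms from $G$ to $H$. (Thus an existence homomorphism into $E_2$ is a 2-coloring of $V(G)$ in which every vertex has a neighbor of the same color.) -}

module Defs where

open import Data.Bool using (Bool; true; false; _∧_; _∨_)
open import Data.Nat using (ℕ; zero; suc; _+_; _≡ᵇ_)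
open import Data.Nat.Properties using (+-comm)
open import Data.Fin using (Fin; zero; suc; toℕ; inject₁; fromℕ; _≟_)
open import Data.Fin.Permutation using (Permutation′; _⟨$⟩ʳ_)
open import Data.List using (List; []; _∷_; map; concatMap; filter; length; allFin)
open import Data.Bool.ListAction using (all; any)
open import Data.Product using (Σ; _×_; _,_)
open import Relation.Nullary using (¬_; does)
open import Relation.Binary.PropositionalEquality using (_≡_; refl)
open import Function.Definitions using (Injective)

record Graph (n : ℕ) : Set where
  field
    adj      : Fin n → Fin n → Bool
    adj-sym  : ∀ u v → adj u v ≡ adj v u
    adj-irr  : ∀ v → adj v v ≡ false
open Graph public

record LGraph (k : ℕ) : Set where
  field
    ladj     : Fin k → Fin k → Bool
    ladj-sym : ∀ u v → ladj u v ≡ ladj v u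
open LGraph public

E₂ : LGraph 2
E₂ = record { ladj = λ i j → does (i ≟ j) ; ladj-sym = sym≟ }
  where
  sym≟ : ∀ (u v : Fin 2) → does (u ≟ v) ≡ does (v ≟ u)
  sym≟ zero zero = refl
  sym≟ zero (suc zero) = refl
  sym≟ (suc zero) zero = refl
  sym≟ (suc zero) (suc zero) = refl

consF : ∀ {n k} → Fin k → (Fin n → Fin k) → Fin (suc n) → Fin k
consF c f zero = c
consF c f (suc i) = f i

allMaps : (n k : ℕ) → List (Fin n → Fin k)
allMaps zero k = (λ ()) ∷ []
allMaps (suc n) k = concatMap (λ f → map (λ c → consF c f) (allFin k)) (allMaps n k)

isXhom : ∀ {n k} → Graph n → LGraph k → (Fin n → Fin k) → Bool
isXhom {n} G H φ = all (λ v → any (λ w → adj G v w ∧ ladj H (φ v) (φ w)) (allFin n)) (allFin n)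

xhom : ∀ {n k} → Graph n → LGraph k → ℕ
xhom {n} {k} G H = length (filter (λ φ → isXhom G H φ ≡? true) (allMaps n k))
  where
  open import Data.Bool.Properties using () renaming (_≟_ to _≡?_)

data Walk {n} (G : Graph n) : Fin n → Fin n → Set where
  here : ∀ {v} → Walk G v v
  step : ∀ {u w v} → adj G u w ≡ true → Walk G w v → Walk G u v

Connected : ∀ {n} → Graph n → Set
Connected {n} G = ∀ (u v : Fin n) → Walk G u v

HasCycle : ∀ {n} → Graph n → Set
HasCycle {n} G =
  Σ ℕ λ m → Σ (Fin (suc (suc (suc m))) → Fin n) λ f →
    Injective _≡_ _≡_ f ×
    (∀ (i : Fin (suc (suc m))) → adj G (f (inject₁ i)) (f (suc i)) ≡ true) ×
    adj G (f (fromℕ (suc (suc m)))) (f zero) ≡ true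

IsTree : ∀ {n} → Graph n → Set
IsTree G = Connected G × ¬ HasCycle G

private
  pathAdj : ∀ {n} → Fin n → Fin n → Bool
  pathAdj i j = ((suc (toℕ i)) ≡ᵇ toℕ j) ∨ ((suc (toℕ j)) ≡ᵇ toℕ i)

  pathSym : ∀ {n} (i j : Fin n) → pathAdj i j ≡ pathAdj j i
  pathSym i j with (suc (toℕ i)) ≡ᵇ toℕ j | (suc (toℕ j)) ≡ᵇ toℕ i
  ... | true  | true  = refl
  ... | true  | false = refl
  ... | false | true  = refl
  ... | false | false = refl

  sn≢n : ∀ m → (suc m ≡ᵇ m) ≡ false
  sn≢n zero = refl
  sn≢n (suc m) = sn≢n m

  pathIrr : ∀ {n} (i : Fin n) → pathAdj i i ≡ false
  pathIrr i with sn≢n (toℕ i)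
  ... | e rewrite e = refl

P : (n : ℕ) → Graph n
P n = record { adj = pathAdj ; adj-sym = pathSym ; adj-irr = pathIrr }

_≅_ : ∀ {n} → Graph n → Graph n → Set
_≅_ {n} G H = Σ (Permutation′ n) λ σ → ∀ u v → adj H (σ ⟨$⟩ʳ u) (σ ⟨$⟩ʳ v) ≡ adj G u v

module Submission where

-- An existence homomorphism to E₂ is a 2-colouring in which every vertex is
-- satisfied: it has a neighbour of its own colour.
-- The key identity (LeafRemoval.count-leaf): for a leaf v with neighbour u,
--   x(G) = x(G ∖ v) + #(colourings of G ∖ v satisfying every vertex except u).
-- The second term is at most x(G ∖ v ∖ u) if u has a neighbour in G ∖ v, at most
-- twice that in general, and equal to it if u is itself a leaf (module Deficient).
-- Acyclic graphs have an isolated vertex (then x = 0) or a leaf, so by induction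
-- every forest satisfies x ≤ pathCount n, which the path attains (count-path).
-- For equality, removing a leaf from an extremal tree makes both bounds tight: by
-- induction the rest is a path, and the leaf must hang at one of its ends
-- (ExtremalStep, InnerStem). The converse is isomorphism invariance (count-iso).

open import Defs
open import Data.Bool using (Bool; true; false; _∧_; _∨_; not)
open import Data.Bool.Properties using (∧-comm; not-involutive; T-≡) renaming (_≟_ to _≟ᴮ_)
open import Data.Bool.ListAction using (all; any)
open import Data.Nat using (ℕ; zero; suc; _+_; _≤_; _<_; z≤n; s≤s; _≡ᵇ_) renaming (_≟_ to _≟ℕ_)
open import Data.Nat.Properties using (+-identityʳ; m+n≡0⇒m≡0; ≤-antisym; +-cancelʳ-≤; 1+n≰n; ≡ᵇ⇒≡; ≡⇒≡ᵇ; suc-injective; n≤1+n; m≤m+n; +-suc; +-cancelˡ-≡; <-irrefl; ≤-pred; ≤∧≢⇒<; m≤n⇒m<n∨m≡n; m≤n⇒∃[o]m+o≡n; m≤n+m; +-comm; module ≤-Reasoning; +-mono-≤; +-monoʳ-≤; ≤-refl; ≤-trans; ≤-reflexive; +-commutativeSemigroup)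
open import Data.Fin using (Fin; zero; suc; toℕ; fromℕ; fromℕ<; inject₁; punchIn; punchOut; _≟_)
open import Data.Fin.Properties using (punchIn-injective; punchIn-punchOut; punchInᵢ≢i; toℕ-injective; toℕ-inject₁; toℕ-fromℕ; toℕ-fromℕ<; toℕ≤pred[n]; toℕ<n; any?; pigeonhole)
open import Data.Fin.Permutation using (Permutation′; id; _⟨$⟩ʳ_; _⟨$⟩ˡ_; inverseʳ; inverseˡ; remove; insert; insert-punchIn)
open import Data.List using (List; []; _∷_; _++_; concatMap; filter; length; tabulate; allFin)
open import Data.List.Properties using (length-++; filter-++)
open import Data.Product using (Σ; _×_; _,_; proj₁; proj₂)
open import Data.Sum using (_⊎_; inj₁; inj₂)
open import Data.Empty using (⊥; ⊥-elim)
open import Relation.Nullary using (¬_; does; yes; no)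
open import Relation.Nullary.Decidable using (dec-true; dec-false; _×-dec_; ¬?)
open import Relation.Binary.PropositionalEquality
open import Function.Definitions using (Injective)
open import Function.Bundles using (Equivalence; _⇔_; mk⇔)
open import Algebra.Properties.CommutativeSemigroup +-commutativeSemigroup using (interchange)

∧-intro : ∀ {a b} → a ≡ true → b ≡ true → a ∧ b ≡ true
∧-intro refl refl = refl

∧-elimˡ : ∀ {a b} → a ∧ b ≡ true → a ≡ true
∧-elimˡ {true} _ = refl

∧-elimʳ : ∀ {a b} → a ∧ b ≡ true → b ≡ true
∧-elimʳ {true} h = h

∨-elim : ∀ {a b} → a ∨ b ≡ true → (a ≡ true) ⊎ (b ≡ true)
∨-elim {true} _ = inj₁ refl
∨-elim {false} h = inj₂ h

∨-introˡ : ∀ {a b} → a ≡ true → a ∨ b ≡ true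
∨-introˡ refl = refl

∨-introʳ : ∀ {a b} → b ≡ true → a ∨ b ≡ true
∨-introʳ {true} _ = refl
∨-introʳ {false} h = h

not-true : ∀ {a} → not a ≡ true → a ≡ false
not-true {false} _ = refl

not-false : ∀ {a} → a ≡ false → not a ≡ true
not-false refl = refl

true≢false : ∀ {a} → a ≡ true → a ≡ false → ⊥
true≢false refl ()

¬true⇒false : ∀ {a} → ¬ (a ≡ true) → a ≡ false
¬true⇒false {true} h = ⊥-elim (h refl)
¬true⇒false {false} _ = refl

bool-ext : ∀ {a b} → (a ≡ true → b ≡ true) → (b ≡ true → a ≡ true) → a ≡ b
bool-ext {true} {true} _ _ = refl
bool-ext {true} {false} h _ = sym (h refl)
bool-ext {false} {true} _ k = k refl
bool-ext {false} {false} _ _ = refl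

does-sound : ∀ {n} {x y : Fin n} → does (x ≟ y) ≡ true → x ≡ y
does-sound {x = x} {y} h with x ≟ y
... | yes e = e

all-tabulate⁻ : ∀ {A : Set} {n} (p : A → Bool) (g : Fin n → A) →
  all p (tabulate g) ≡ true → ∀ i → p (g i) ≡ true
all-tabulate⁻ {n = suc n} p g h zero = ∧-elimˡ h
all-tabulate⁻ {n = suc n} p g h (suc i) = all-tabulate⁻ p (λ j → g (suc j)) (∧-elimʳ h) i

all-tabulate⁺ : ∀ {A : Set} {n} (p : A → Bool) (g : Fin n → A) →
  (∀ i → p (g i) ≡ true) → all p (tabulate g) ≡ true
all-tabulate⁺ {n = zero} p g h = refl
all-tabulate⁺ {n = suc n} p g h = ∧-intro (h zero) (all-tabulate⁺ p (λ j → g (suc j)) (λ i → h (suc i)))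

any-tabulate⁻ : ∀ {A : Set} {n} (p : A → Bool) (g : Fin n → A) →
  any p (tabulate g) ≡ true → Σ (Fin n) λ i → p (g i) ≡ true
any-tabulate⁻ {n = suc n} p g h with ∨-elim {p (g zero)} h
... | inj₁ e = zero , e
... | inj₂ e with any-tabulate⁻ p (λ j → g (suc j)) e
... | i , e′ = suc i , e′

any-tabulate⁺ : ∀ {A : Set} {n} (p : A → Bool) (g : Fin n → A) →
  (i : Fin n) → p (g i) ≡ true → any p (tabulate g) ≡ true
any-tabulate⁺ p g zero h = ∨-introˡ h
any-tabulate⁺ {n = suc n} p g (suc i) h = ∨-introʳ {p (g zero)} (any-tabulate⁺ p (λ j → g (suc j)) i h)

-- Counting 2-colourings.

Colouring : ℕ → Set
Colouring n = Fin n → Fin 2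

c₀ c₁ : Fin 2
c₀ = zero
c₁ = suc zero

𝟙 : Bool → ℕ
𝟙 true = 1
𝟙 false = 0

-- The colouring of the empty vertex set, as it is enumerated by allMaps.
emptyColouring : Colouring 0
emptyColouring with allMaps 0 2
... | φ ∷ _ = φ
... | [] = λ ()

count : (n : ℕ) → (Colouring n → Bool) → ℕ
count zero p = 𝟙 (p emptyColouring)
count (suc n) p = count n (λ φ → p (consF c₀ φ)) + count n (λ φ → p (consF c₁ φ))

#filter : ∀ {n} → (Colouring n → Bool) → List (Colouring n) → ℕ
#filter p L = length (filter (λ φ → p φ ≟ᴮ true) L)

#filter-∷ : ∀ {n} (p : Colouring n → Bool) φ L → #filter p (φ ∷ L) ≡ 𝟙 (p φ) + #filter p L
#filter-∷ p φ L with p φ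
... | true = refl
... | false = refl

#filter-++ : ∀ {n} (p : Colouring n → Bool) L M → #filter p (L ++ M) ≡ #filter p L + #filter p M
#filter-++ p L M = trans (cong length (filter-++ (λ φ → p φ ≟ᴮ true) L M)) (length-++ (filter _ L))

#filter-allMaps : ∀ n (p : Colouring n → Bool) → #filter p (allMaps n 2) ≡ count n p
#filter-allMaps zero p with p emptyColouring
... | true = refl
... | false = refl
#filter-allMaps (suc n) p = begin
  #filter p (allMaps (suc n) 2)                      ≡⟨ branch (allMaps n 2) ⟩
  #filter p₀ (allMaps n 2) + #filter p₁ (allMaps n 2) ≡⟨ cong₂ _+_ (#filter-allMaps n p₀) (#filter-allMaps n p₁) ⟩
  count n p₀ + count n p₁                            ∎
  where
  open ≡-Reasoning
  p₀ p₁ : Colouring n → Bool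
  p₀ φ = p (consF c₀ φ)
  p₁ φ = p (consF c₁ φ)
  -- allMaps (suc n) 2 lists every colouring φ of Fin n twice, extended by c₀ and by c₁.
  branch : ∀ L → #filter p (concatMap (λ φ → consF c₀ φ ∷ consF c₁ φ ∷ []) L) ≡ #filter p₀ L + #filter p₁ L
  branch [] = refl
  branch (φ ∷ L) = begin
    #filter p ((consF c₀ φ ∷ consF c₁ φ ∷ []) ++ concatMap (λ φ → consF c₀ φ ∷ consF c₁ φ ∷ []) L)
      ≡⟨ #filter-++ p (consF c₀ φ ∷ consF c₁ φ ∷ []) _ ⟩
    #filter p (consF c₀ φ ∷ consF c₁ φ ∷ []) + #filter p (concatMap (λ φ → consF c₀ φ ∷ consF c₁ φ ∷ []) L)
      ≡⟨ cong₂ _+_ (trans (#filter-∷ p _ _) (cong (𝟙 (p₀ φ) +_) (trans (#filter-∷ p _ []) (+-identityʳ _)))) (branch L) ⟩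
    (𝟙 (p₀ φ) + 𝟙 (p₁ φ)) + (#filter p₀ L + #filter p₁ L)
      ≡⟨ interchange (𝟙 (p₀ φ)) (𝟙 (p₁ φ)) _ _ ⟩
    (𝟙 (p₀ φ) + #filter p₀ L) + (𝟙 (p₁ φ) + #filter p₁ L)
      ≡⟨ sym (cong₂ _+_ (#filter-∷ p₀ φ L) (#filter-∷ p₁ φ L)) ⟩
    #filter p₀ (φ ∷ L) + #filter p₁ (φ ∷ L) ∎

isXhom₂ : ∀ {n} → Graph n → Colouring n → Bool
isXhom₂ G = isXhom G E₂

xhom≡count : ∀ {n} (G : Graph n) → xhom G E₂ ≡ count n (isXhom₂ G)
xhom≡count {n} G = #filter-allMaps n (isXhom₂ G)

count-cong : ∀ n {p q : Colouring n → Bool} → (∀ φ → p φ ≡ q φ) → count n p ≡ count n q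
count-cong zero e = cong 𝟙 (e emptyColouring)
count-cong (suc n) e = cong₂ _+_ (count-cong n (λ φ → e (consF c₀ φ))) (count-cong n (λ φ → e (consF c₁ φ)))

count-mono : ∀ n {p q : Colouring n → Bool} → (∀ φ → p φ ≡ true → q φ ≡ true) → count n p ≤ count n q
count-mono zero h = 𝟙-mono (h emptyColouring)
  where
  𝟙-mono : ∀ {a b} → (a ≡ true → b ≡ true) → 𝟙 a ≤ 𝟙 b
  𝟙-mono {false} _ = z≤n
  𝟙-mono {true} h rewrite h refl = ≤-refl
count-mono (suc n) h = +-mono-≤ (count-mono n (λ φ → h (consF c₀ φ))) (count-mono n (λ φ → h (consF c₁ φ)))

count-none : ∀ n {p : Colouring n → Bool} → (∀ φ → p φ ≡ false) → count n p ≡ 0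
count-none zero h rewrite h emptyColouring = refl
count-none (suc n) h rewrite count-none n (λ φ → h (consF c₀ φ)) | count-none n (λ φ → h (consF c₁ φ)) = refl

count-suc-+ : ∀ n (p q r : Colouring (suc n) → Bool) →
  (∀ d → count n (λ φ → p (consF d φ)) ≡ count n (λ φ → q (consF d φ)) + count n (λ φ → r (consF d φ))) →
  count (suc n) p ≡ count (suc n) q + count (suc n) r
count-suc-+ n p q r h = trans (cong₂ _+_ (h c₀) (h c₁)) (interchange (branch q c₀) (branch r c₀) (branch q c₁) (branch r c₁))
  where
  branch : (Colouring (suc n) → Bool) → Fin 2 → ℕ
  branch s d = count n (λ φ → s (consF d φ))

count-split : ∀ n (p b : Colouring n → Bool) →
  count n p ≡ count n (λ φ → p φ ∧ b φ) + count n (λ φ → p φ ∧ not (b φ))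
count-split zero p b = 𝟙-split (p emptyColouring) (b emptyColouring)
  where
  𝟙-split : ∀ x y → 𝟙 x ≡ 𝟙 (x ∧ y) + 𝟙 (x ∧ not y)
  𝟙-split true true = refl
  𝟙-split true false = refl
  𝟙-split false _ = refl
count-split (suc n) p b = count-suc-+ n p (λ φ → p φ ∧ b φ) (λ φ → p φ ∧ not (b φ))
  (λ d → count-split n (λ φ → p (consF d φ)) (λ φ → b (consF d φ)))

-- ins v c φ extends a colouring of Fin n to Fin (suc n) by giving the new
-- vertex v the colour c; the old vertices sit at punchIn v.
ins : ∀ {n} → Fin (suc n) → Fin 2 → Colouring n → Colouring (suc n)
ins zero c φ = consF c φ
ins {suc n} (suc v) c φ = consF (φ zero) (ins v c (λ i → φ (suc i)))

ins-here : ∀ {n} (v : Fin (suc n)) c φ → ins v c φ v ≡ c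
ins-here zero c φ = refl
ins-here {suc n} (suc v) c φ = ins-here v c (λ i → φ (suc i))

ins-punchIn : ∀ {n} (v : Fin (suc n)) c φ a → ins v c φ (punchIn v a) ≡ φ a
ins-punchIn zero c φ a = refl
ins-punchIn {suc n} (suc v) c φ zero = refl
ins-punchIn {suc n} (suc v) c φ (suc a) = ins-punchIn v c (λ i → φ (suc i)) a

ins-cong : ∀ {n} (v : Fin (suc n)) c {φ ψ : Colouring n} → (∀ i → φ i ≡ ψ i) → ∀ x → ins v c φ x ≡ ins v c ψ x
ins-cong zero c e zero = refl
ins-cong zero c e (suc x) = e x
ins-cong {suc n} (suc v) c e zero = e zero
ins-cong {suc n} (suc v) c e (suc x) = ins-cong v c (λ i → e (suc i)) x

count-at : ∀ n (v : Fin (suc n)) (p : Colouring (suc n) → Bool) →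
  count (suc n) p ≡ count n (λ φ → p (ins v c₀ φ)) + count n (λ φ → p (ins v c₁ φ))
count-at n zero p = refl
count-at (suc n) (suc v) p =
  trans (cong₂ _+_ (count-at n v (λ φ → p (consF c₀ φ))) (count-at n v (λ φ → p (consF c₁ φ))))
        (interchange (branch c₀ c₀) (branch c₀ c₁) (branch c₁ c₀) (branch c₁ c₁))
  where
  branch : Fin 2 → Fin 2 → ℕ
  branch d c = count n (λ φ → p (consF d (ins v c φ)))

c₁-is-not-c₀ : ∀ x → does (c₁ ≟ x) ≡ not (does (c₀ ≟ x))
c₁-is-not-c₀ zero = refl
c₁-is-not-c₀ (suc zero) = refl

Satisfied : ∀ {n} → Graph n → Colouring n → Fin n → Set
Satisfied {n} G φ a = Σ (Fin n) λ w → (adj G a w ≡ true) × (φ a ≡ φ w)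

satisfied? : ∀ {n} → Graph n → Colouring n → Fin n → Bool
satisfied? {n} G φ a = any (λ w → adj G a w ∧ does (φ a ≟ φ w)) (allFin n)

satisfied?-sound : ∀ {n} (G : Graph n) φ a → satisfied? G φ a ≡ true → Satisfied G φ a
satisfied?-sound G φ a h with any-tabulate⁻ (λ w → adj G a w ∧ does (φ a ≟ φ w)) (λ x → x) h
... | w , e = w , ∧-elimˡ e , does-sound (∧-elimʳ {adj G a w} e)

satisfied?-complete : ∀ {n} (G : Graph n) φ a → Satisfied G φ a → satisfied? G φ a ≡ true
satisfied?-complete G φ a (w , aw , e) =
  any-tabulate⁺ (λ w → adj G a w ∧ does (φ a ≟ φ w)) (λ x → x) w (∧-intro aw (dec-true (φ a ≟ φ w) e))

isXhom₂-sound : ∀ {n} (G : Graph n) φ → isXhom₂ G φ ≡ true → ∀ a → Satisfied G φ a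
isXhom₂-sound G φ h a = satisfied?-sound G φ a (all-tabulate⁻ (satisfied? G φ) (λ x → x) h a)

isXhom₂-complete : ∀ {n} (G : Graph n) φ → (∀ a → Satisfied G φ a) → isXhom₂ G φ ≡ true
isXhom₂-complete G φ h = all-tabulate⁺ (satisfied? G φ) (λ x → x) (λ a → satisfied?-complete G φ a (h a))

-- A vertex without neighbours can never be satisfied.
isolated-no-xhom : ∀ {n} (G : Graph n) x → (∀ w → adj G x w ≡ false) → ∀ φ → isXhom₂ G φ ≡ false
isolated-no-xhom G x iso φ = ¬true⇒false λ h → let (w , aw , _) = isXhom₂-sound G φ h x in true≢false aw (iso w)

allBut? : ∀ {n} → Graph n → Fin n → Colouring n → Bool
allBut? {n} G u φ = all (λ a → does (a ≟ u) ∨ satisfied? G φ a) (allFin n)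

allBut?-sound : ∀ {n} (G : Graph n) u φ → allBut? G u φ ≡ true → ∀ a → ¬ (a ≡ u) → Satisfied G φ a
allBut?-sound G u φ h a a≢u with ∨-elim (all-tabulate⁻ (λ a → does (a ≟ u) ∨ satisfied? G φ a) (λ x → x) h a)
... | inj₁ e = ⊥-elim (a≢u (does-sound e))
... | inj₂ e = satisfied?-sound G φ a e

allBut?-complete : ∀ {n} (G : Graph n) u φ → (∀ a → ¬ (a ≡ u) → Satisfied G φ a) → allBut? G u φ ≡ true
allBut?-complete G u φ h = all-tabulate⁺ (λ a → does (a ≟ u) ∨ satisfied? G φ a) (λ x → x) each
  where
  each : ∀ a → does (a ≟ u) ∨ satisfied? G φ a ≡ true
  each a with a ≟ u
  ... | yes _ = refl
  ... | no a≢u = satisfied?-complete G φ a (h a a≢u)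

allBut?-∧-satisfied : ∀ {n} (G : Graph n) u φ → allBut? G u φ ∧ satisfied? G φ u ≡ isXhom₂ G φ
allBut?-∧-satisfied G u φ = bool-ext
  (λ h → isXhom₂-complete G φ (λ a → each a (∧-elimˡ h) (satisfied?-sound G φ u (∧-elimʳ {allBut? G u φ} h))))
  (λ h → ∧-intro (allBut?-complete G u φ (λ a _ → isXhom₂-sound G φ h a))
                 (satisfied?-complete G φ u (isXhom₂-sound G φ h u)))
  where
  each : ∀ a → allBut? G u φ ≡ true → Satisfied G φ u → Satisfied G φ a
  each a hR su with a ≟ u
  ... | yes refl = su
  ... | no a≢u = allBut?-sound G u φ hR a a≢u

deficient? : ∀ {n} → Graph n → Fin n → Colouring n → Bool
deficient? G u φ = allBut? G u φ ∧ not (satisfied? G φ u)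

infixl 30 _∖_
_∖_ : ∀ {n} → Graph (suc n) → Fin (suc n) → Graph n
G ∖ v = record
  { adj = λ a b → adj G (punchIn v a) (punchIn v b)
  ; adj-sym = λ a b → adj-sym G (punchIn v a) (punchIn v b)
  ; adj-irr = λ a → adj-irr G (punchIn v a) }

punchIn-cover : ∀ {n} (v x : Fin (suc n)) → (x ≡ v) ⊎ (Σ (Fin n) λ a → punchIn v a ≡ x)
punchIn-cover v x with v ≟ x
... | yes e = inj₁ (sym e)
... | no v≢x = inj₂ (punchOut v≢x , punchIn-punchOut v≢x)

record IsLeaf {n} (G : Graph (suc n)) (v : Fin (suc n)) (u : Fin n) : Set where
  field
    edge : adj G v (punchIn v u) ≡ true
    only : ∀ w → adj G v w ≡ true → w ≡ punchIn v u

stem-only : ∀ {n} {G : Graph (suc n)} {v u} → IsLeaf G v u → ∀ a → adj G (punchIn v a) v ≡ true → a ≡ u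
stem-only {G = G} {v} {u} leaf a h = punchIn-injective v a u (IsLeaf.only leaf (punchIn v a) (trans (adj-sym G v (punchIn v a)) h))

off-leaf : ∀ {n} {G : Graph (suc n)} {v u} → IsLeaf G v u → ∀ c y → ¬ (c ≡ u) → adj G (punchIn v c) y ≡ true →
  Σ (Fin n) λ d → (punchIn v d ≡ y) × (adj (G ∖ v) c d ≡ true)
off-leaf {v = v} leaf c y c≢u h with punchIn-cover v y
... | inj₁ refl = ⊥-elim (c≢u (stem-only leaf c h))
... | inj₂ (d , refl) = d , refl , h

-- Removing a leaf v with neighbour u: the existence homomorphisms of G are
-- those of G ∖ v, together with the colourings of G ∖ v deficient at u
-- (then v, coloured like u, is the only vertex that satisfies u).
module LeafRemoval {n} (G : Graph (suc n)) (v : Fin (suc n)) (u : Fin n) (leaf : IsLeaf G v u) where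

  open IsLeaf leaf

  G′ : Graph n
  G′ = G ∖ v

  xhom-with-leaf : ∀ c φ → isXhom₂ G (ins v c φ) ≡ does (c ≟ φ u) ∧ allBut? G′ u φ
  xhom-with-leaf c φ = bool-ext
    (λ h → ∧-intro (dec-true (c ≟ φ u) (leaf-matches (isXhom₂-sound G ψ h)))
                   (allBut?-complete G′ u φ (others (isXhom₂-sound G ψ h))))
    (λ h → isXhom₂-complete G ψ (extend (does-sound (∧-elimˡ h)) (∧-elimʳ {does (c ≟ φ u)} h)))
    where
    ψ = ins v c φ
    leaf-matches : (∀ x → Satisfied G ψ x) → c ≡ φ u
    leaf-matches sat with sat v
    ... | w , aw , e with only w aw
    ... | refl = trans (sym (ins-here v c φ)) (trans e (ins-punchIn v c φ u))
    others : (∀ x → Satisfied G ψ x) → ∀ a → ¬ (a ≡ u) → Satisfied G′ φ a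
    others sat a a≢u with sat (punchIn v a)
    ... | w , aw , e with off-leaf leaf a w a≢u aw
    ... | w′ , refl , aw′ = w′ , aw′ , trans (sym (ins-punchIn v c φ a)) (trans e (ins-punchIn v c φ w′))
    extend : c ≡ φ u → allBut? G′ u φ ≡ true → ∀ x → Satisfied G ψ x
    extend c≡φu hR x with punchIn-cover v x
    ... | inj₁ refl = punchIn v u , edge , trans (ins-here v c φ) (trans c≡φu (sym (ins-punchIn v c φ u)))
    ... | inj₂ (a , refl) with a ≟ u
    ... | yes refl = v , trans (adj-sym G _ v) edge , trans (ins-punchIn v c φ u) (trans (sym c≡φu) (sym (ins-here v c φ)))
    ... | no a≢u with allBut?-sound G′ u φ hR a a≢u
    ... | w , aw , e = punchIn v w , aw , trans (ins-punchIn v c φ a) (trans e (sym (ins-punchIn v c φ w)))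

  count-leaf : count (suc n) (isXhom₂ G) ≡ count n (isXhom₂ G′) + count n (deficient? G′ u)
  count-leaf = begin
    count (suc n) (isXhom₂ G)
      ≡⟨ count-at n v (isXhom₂ G) ⟩
    count n (λ φ → isXhom₂ G (ins v c₀ φ)) + count n (λ φ → isXhom₂ G (ins v c₁ φ))
      ≡⟨ cong₂ _+_ (count-cong n (λ φ → trans (xhom-with-leaf c₀ φ) (∧-comm (does (c₀ ≟ φ u)) _)))
                   (count-cong n (λ φ → trans (xhom-with-leaf c₁ φ)
                      (trans (∧-comm (does (c₁ ≟ φ u)) _) (cong (allBut? G′ u φ ∧_) (c₁-is-not-c₀ (φ u)))))) ⟩
    count n (λ φ → allBut? G′ u φ ∧ does (c₀ ≟ φ u)) + count n (λ φ → allBut? G′ u φ ∧ not (does (c₀ ≟ φ u)))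
      ≡⟨ sym (count-split n (allBut? G′ u) (λ φ → does (c₀ ≟ φ u))) ⟩
    count n (allBut? G′ u)
      ≡⟨ count-split n (allBut? G′ u) (λ φ → satisfied? G′ φ u) ⟩
    count n (λ φ → allBut? G′ u φ ∧ satisfied? G′ φ u) + count n (deficient? G′ u)
      ≡⟨ cong (_+ count n (deficient? G′ u)) (count-cong n (allBut?-∧-satisfied G′ u)) ⟩
    count n (isXhom₂ G′) + count n (deficient? G′ u) ∎
    where open ≡-Reasoning

-- avoids? G u d g: giving u the colour d, no neighbour of u has u's colour
-- (g colours the vertices of G ∖ u).
avoids? : ∀ {m} → Graph (suc m) → Fin (suc m) → Fin 2 → Colouring m → Bool
avoids? {m} G u d g = all (λ w → not (adj G u (punchIn u w)) ∨ not (does (d ≟ g w))) (allFin m)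

avoids?-sound : ∀ {m} (G : Graph (suc m)) u d g → avoids? G u d g ≡ true →
  ∀ w → adj G u (punchIn u w) ≡ true → ¬ (d ≡ g w)
avoids?-sound G u d g h w aw d≡gw
  with ∨-elim (all-tabulate⁻ (λ w → not (adj G u (punchIn u w)) ∨ not (does (d ≟ g w))) (λ x → x) h w)
... | inj₁ e = true≢false aw (not-true e)
... | inj₂ e = true≢false (dec-true (d ≟ g w) d≡gw) (not-true e)

avoids?-complete : ∀ {m} (G : Graph (suc m)) u d g →
  (∀ w → adj G u (punchIn u w) ≡ true → ¬ (d ≡ g w)) → avoids? G u d g ≡ true
avoids?-complete G u d g h = all-tabulate⁺ (λ w → not (adj G u (punchIn u w)) ∨ not (does (d ≟ g w))) (λ x → x) each
  where
  each : ∀ w → not (adj G u (punchIn u w)) ∨ not (does (d ≟ g w)) ≡ true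
  each w with adj G u (punchIn u w) in aw
  ... | false = refl
  ... | true = not-false (dec-false (d ≟ g w) (h w aw))

avoids?-leaf : ∀ {m} (G : Graph (suc m)) u w₀ → IsLeaf G u w₀ → ∀ d g → avoids? G u d g ≡ not (does (d ≟ g w₀))
avoids?-leaf G u w₀ leaf d g = bool-ext
  (λ h → not-false (dec-false (d ≟ g w₀) (avoids?-sound G u d g h w₀ (IsLeaf.edge leaf))))
  (λ h → avoids?-complete G u d g λ w aw d≡gw →
           true≢false (dec-true (d ≟ g w₀) (trans d≡gw (cong g (punchIn-injective u w w₀ (IsLeaf.only leaf _ aw)))))
                      (not-true h))

-- The colourings deficient at u are counted by the existence homomorphisms g of
-- G ∖ u together with a colour for u that no neighbour of u carries under g.
module Deficient {m} (G : Graph (suc m)) (u : Fin (suc m)) where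

  X : Colouring m → Bool
  X = isXhom₂ (G ∖ u)

  deficient-ins : ∀ d g → deficient? G u (ins u d g) ≡ X g ∧ avoids? G u d g
  deficient-ins d g = bool-ext to from
    where
    F = ins u d g
    u-unsatisfied : deficient? G u F ≡ true → ¬ Satisfied G F u
    u-unsatisfied h s = true≢false (satisfied?-complete G F u s) (not-true (∧-elimʳ {allBut? G u F} h))
    to : deficient? G u F ≡ true → X g ∧ avoids? G u d g ≡ true
    to h = ∧-intro (isXhom₂-complete (G ∖ u) g restrict) (avoids?-complete G u d g avoid)
      where
      restrict : ∀ a → Satisfied (G ∖ u) g a
      restrict a with allBut?-sound G u F (∧-elimˡ h) (punchIn u a) (punchInᵢ≢i u a)
      ... | w , aw , e with punchIn-cover u w
      ... | inj₁ refl = ⊥-elim (u-unsatisfied h (punchIn u a , trans (adj-sym G u _) aw , sym e))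
      ... | inj₂ (w′ , refl) = w′ , aw , trans (sym (ins-punchIn u d g a)) (trans e (ins-punchIn u d g w′))
      avoid : ∀ w → adj G u (punchIn u w) ≡ true → ¬ (d ≡ g w)
      avoid w aw d≡gw = u-unsatisfied h (punchIn u w , aw , trans (ins-here u d g) (trans d≡gw (sym (ins-punchIn u d g w))))
    from : X g ∧ avoids? G u d g ≡ true → deficient? G u F ≡ true
    from h = ∧-intro (allBut?-complete G u F others) (not-false (¬true⇒false (λ s → unsat (satisfied?-sound G F u s))))
      where
      others : ∀ x → ¬ (x ≡ u) → Satisfied G F x
      others x x≢u with punchIn-cover u x
      ... | inj₁ x≡u = ⊥-elim (x≢u x≡u)
      ... | inj₂ (a , refl) with isXhom₂-sound (G ∖ u) g (∧-elimˡ h) a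
      ... | w , aw , e = punchIn u w , aw , trans (ins-punchIn u d g a) (trans e (sym (ins-punchIn u d g w)))
      unsat : ¬ Satisfied G F u
      unsat (w , aw , e) with punchIn-cover u w
      ... | inj₁ refl = true≢false aw (adj-irr G u)
      ... | inj₂ (w′ , refl) = avoids?-sound G u d g (∧-elimʳ {X g} h) w′ aw
                                 (trans (sym (ins-here u d g)) (trans e (ins-punchIn u d g w′)))

  count-deficient : count (suc m) (deficient? G u)
                  ≡ count m (λ g → X g ∧ avoids? G u c₀ g) + count m (λ g → X g ∧ avoids? G u c₁ g)
  count-deficient = trans (count-at m u (deficient? G u))
    (cong₂ _+_ (count-cong m (deficient-ins c₀)) (count-cong m (deficient-ins c₁)))

  -- In general u has at most two admissible colours.
  deficient-bound : count (suc m) (deficient? G u) ≤ count m X + count m X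
  deficient-bound = ≤-trans (≤-reflexive count-deficient)
    (+-mono-≤ (count-mono m (λ g → ∧-elimˡ)) (count-mono m (λ g → ∧-elimˡ)))

  -- If u has a neighbour, its colour is forced.
  deficient-bound-edge : ∀ w₀ → adj G u (punchIn u w₀) ≡ true → count (suc m) (deficient? G u) ≤ count m X
  deficient-bound-edge w₀ aw₀ = begin
    count (suc m) (deficient? G u)
      ≡⟨ count-deficient ⟩
    count m (λ g → X g ∧ avoids? G u c₀ g) + count m (λ g → X g ∧ avoids? G u c₁ g)
      ≤⟨ +-monoʳ-≤ (count m (λ g → X g ∧ avoids? G u c₀ g)) (count-mono m exclusive) ⟩
    count m (λ g → X g ∧ avoids? G u c₀ g) + count m (λ g → X g ∧ not (avoids? G u c₀ g))
      ≡⟨ sym (count-split m X (avoids? G u c₀)) ⟩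
    count m X ∎
    where
    open ≤-Reasoning
    exclusive : ∀ g → X g ∧ avoids? G u c₁ g ≡ true → X g ∧ not (avoids? G u c₀ g) ≡ true
    exclusive g h = ∧-intro (∧-elimˡ h) (not-false (¬true⇒false λ h₀ →
      true≢false (trans (c₁-is-not-c₀ (g w₀)) (not-false (dec-false (c₀ ≟ g w₀) (avoids?-sound G u c₀ g h₀ w₀ aw₀))))
                 (dec-false (c₁ ≟ g w₀) (avoids?-sound G u c₁ g (∧-elimʳ {X g} h) w₀ aw₀))))

  -- If u is a leaf, its colour is determined, and always available.
  deficient-count-leaf : ∀ w₀ → IsLeaf G u w₀ → count (suc m) (deficient? G u) ≡ count m X
  deficient-count-leaf w₀ leaf = begin
    count (suc m) (deficient? G u)
      ≡⟨ count-deficient ⟩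
    count m (λ g → X g ∧ avoids? G u c₀ g) + count m (λ g → X g ∧ avoids? G u c₁ g)
      ≡⟨ cong₂ _+_ (count-cong m (λ g → cong (X g ∧_) (avoids?-leaf G u w₀ leaf c₀ g)))
                   (count-cong m (λ g → cong (X g ∧_) (trans (avoids?-leaf G u w₀ leaf c₁ g)
                                                         (trans (cong not (c₁-is-not-c₀ (g w₀))) (not-involutive _))))) ⟩
    count m (λ g → X g ∧ not (does (c₀ ≟ g w₀))) + count m (λ g → X g ∧ does (c₀ ≟ g w₀))
      ≡⟨ +-comm (count m (λ g → X g ∧ not (does (c₀ ≟ g w₀)))) _ ⟩
    count m (λ g → X g ∧ does (c₀ ≟ g w₀)) + count m (λ g → X g ∧ not (does (c₀ ≟ g w₀)))
      ≡⟨ sym (count-split m X (λ g → does (c₀ ≟ g w₀))) ⟩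
    count m X ∎
    where open ≡-Reasoning

-- If another vertex a hangs at u as a leaf, no colouring is deficient at u:
-- whatever satisfies a gives a the colour of u.
pendant-no-deficient : ∀ {n} (G : Graph n) (u a : Fin n) → ¬ (a ≡ u) → adj G a u ≡ true →
  (∀ w → adj G a w ≡ true → w ≡ u) → ∀ φ → deficient? G u φ ≡ false
pendant-no-deficient G u a a≢u au only φ = ¬true⇒false λ h →
  true≢false (satisfied?-complete G φ u (u-satisfied (∧-elimˡ h))) (not-true (∧-elimʳ {allBut? G u φ} h))
  where
  u-satisfied : allBut? G u φ ≡ true → Satisfied G φ u
  u-satisfied hR with allBut?-sound G u φ hR a a≢u
  ... | w , aw , e with only w aw
  ... | refl = a , trans (adj-sym G u a) au , sym e

-- Acyclic graphs have vertices of degree at most one.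

AtMostOneNeighbour : ∀ {n} → Graph n → Fin n → Set
AtMostOneNeighbour G x = ∀ w w′ → adj G x w ≡ true → adj G x w′ ≡ true → w ≡ w′

record IsPath {n} (G : Graph n) (p : ℕ → Fin n) (k : ℕ) : Set where
  field
    distinct : ∀ {a b} → a ≤ k → b ≤ k → p a ≡ p b → a ≡ b
    linked   : ∀ a → a < k → adj G (p a) (p (suc a)) ≡ true

module _ {n} {G : Graph n} where

  path-short : ∀ {p k} → IsPath G p k → ¬ (n ≤ k)
  path-short {p} {k} path n≤k with pigeonhole (s≤s n≤k) (λ (i : Fin (suc k)) → p (toℕ i))
  ... | i , j , i<j , e = <-irrefl (IsPath.distinct path (toℕ≤pred[n] i) (toℕ≤pred[n] j) e) i<j

  chord-cycle : ∀ {p k} i → IsPath G p k → suc (suc i) ≤ k → adj G (p k) (p i) ≡ true → HasCycle G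
  chord-cycle {p} {k} i path i+2≤k closing with m≤n⇒∃[o]m+o≡n i+2≤k
  ... | m , e = m , f , f-injective , f-linked , f-closed
    where
    top : i + suc (suc m) ≡ k
    top = trans (+-suc i (suc m)) (trans (cong suc (+-suc i m)) e)
    f : Fin (suc (suc (suc m))) → Fin n
    f j = p (i + toℕ j)
    in-range : ∀ (j : Fin (suc (suc (suc m)))) → i + toℕ j ≤ k
    in-range j = subst (i + toℕ j ≤_) top (+-monoʳ-≤ i (toℕ≤pred[n] j))
    f-injective : Injective _≡_ _≡_ f
    f-injective {a} {b} h = toℕ-injective (+-cancelˡ-≡ i (toℕ a) (toℕ b) (IsPath.distinct path (in-range a) (in-range b) h))
    f-linked : ∀ (j : Fin (suc (suc m))) → adj G (f (inject₁ j)) (f (suc j)) ≡ true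
    f-linked j rewrite toℕ-inject₁ j | +-suc i (toℕ j) = IsPath.linked path (i + toℕ j) (subst (_≤ k) (+-suc i (toℕ j)) (in-range (suc j)))
    f-closed : adj G (f (fromℕ (suc (suc m)))) (f zero) ≡ true
    f-closed rewrite toℕ-fromℕ (suc (suc m)) | +-identityʳ i | top = closing

  snoc : (ℕ → Fin n) → ℕ → Fin n → ℕ → Fin n
  snoc p k w a with a ≟ℕ k
  ... | yes _ = w
  ... | no _ = p a

  snoc-last : ∀ p k w → snoc p k w k ≡ w
  snoc-last p k w with k ≟ℕ k
  ... | yes _ = refl
  ... | no k≢k = ⊥-elim (k≢k refl)

  snoc-init : ∀ p k w a → a < k → snoc p k w a ≡ p a
  snoc-init p k w a a<k with a ≟ℕ k
  ... | yes refl = ⊥-elim (<-irrefl refl a<k)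
  ... | no _ = refl

  extend-path : ∀ {p k w} → IsPath G p k → adj G (p k) w ≡ true → (∀ a → a ≤ k → ¬ (p a ≡ w)) →
    IsPath G (snoc p (suc k) w) (suc k)
  extend-path {p} {k} {w} path edge fresh = record { distinct = distinct′ ; linked = linked′ }
    where
    old : ∀ a → a ≤ k → snoc p (suc k) w a ≡ p a
    old a a≤k = snoc-init p (suc k) w a (s≤s a≤k)
    last-or-old : ∀ a → a ≤ suc k → (a ≡ suc k) ⊎ (a ≤ k)
    last-or-old a a≤ with m≤n⇒m<n∨m≡n a≤
    ... | inj₁ (s≤s a≤k) = inj₂ a≤k
    ... | inj₂ a≡ = inj₁ a≡
    distinct′ : ∀ {a b} → a ≤ suc k → b ≤ suc k → snoc p (suc k) w a ≡ snoc p (suc k) w b → a ≡ b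
    distinct′ {a} {b} ha hb e with last-or-old a ha | last-or-old b hb
    ... | inj₁ refl | inj₁ refl = refl
    ... | inj₁ refl | inj₂ b≤k = ⊥-elim (fresh b b≤k (trans (sym (old b b≤k)) (trans (sym e) (snoc-last p (suc k) w))))
    ... | inj₂ a≤k | inj₁ refl = ⊥-elim (fresh a a≤k (trans (sym (old a a≤k)) (trans e (snoc-last p (suc k) w))))
    ... | inj₂ a≤k | inj₂ b≤k = IsPath.distinct path a≤k b≤k (trans (sym (old a a≤k)) (trans e (old b b≤k)))
    linked′ : ∀ a → a < suc k → adj G (snoc p (suc k) w a) (snoc p (suc k) w (suc a)) ≡ true
    linked′ a (s≤s a≤k) with last-or-old (suc a) (s≤s a≤k)
    ... | inj₁ refl rewrite old k ≤-refl | snoc-last p (suc k) w = edge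
    ... | inj₂ a<k rewrite old a a≤k | old (suc a) a<k = IsPath.linked path a a<k

  module _ (acyclic : ¬ HasCycle G) where

    -- Walk along a path until its last vertex has no further neighbour; the
    -- walk cannot return to the path (no cycles) and cannot run out of vertices.
    grow : (fuel k : ℕ) (p : ℕ → Fin n) → IsPath G p (suc k) → n ≤ suc k + fuel →
      Σ (Fin n) (AtMostOneNeighbour G)
    grow zero k p path n≤ = ⊥-elim (path-short path (subst (n ≤_) (+-identityʳ (suc k)) n≤))
    grow (suc fuel) k p path n≤ with any? (λ w → (adj G (p (suc k)) w ≟ᴮ true) ×-dec ¬? (w ≟ p k))
    ... | no none = p (suc k) , λ w w′ aw aw′ → trans (backward w aw) (sym (backward w′ aw′))
      where
      backward : ∀ w → adj G (p (suc k)) w ≡ true → w ≡ p k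
      backward w aw with w ≟ p k
      ... | yes e = e
      ... | no w≢pk = ⊥-elim (none (w , aw , w≢pk))
    ... | yes (w , aw , w≢pk) with any? (λ (i : Fin (suc (suc k))) → p (toℕ i) ≟ w)
    ... | yes (i , e) = ⊥-elim (acyclic (chord-cycle (toℕ i) path i+2≤ (subst (λ z → adj G (p (suc k)) z ≡ true) (sym e) aw)))
      where
      i≢last : toℕ i ≢ suc k
      i≢last h = true≢false (subst (λ z → adj G (p (suc k)) z ≡ true) (trans (sym e) (cong p h)) aw) (adj-irr G (p (suc k)))
      i≢prev : toℕ i ≢ k
      i≢prev h = w≢pk (trans (sym e) (cong p h))
      i+2≤ : suc (suc (toℕ i)) ≤ suc k
      i+2≤ = s≤s (≤∧≢⇒< (≤-pred (≤∧≢⇒< (toℕ≤pred[n] i) i≢last)) i≢prev)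
    ... | no unvisited = grow fuel (suc k) (snoc p (suc (suc k)) w) (extend-path path aw fresh)
                              (subst (n ≤_) (+-suc (suc k) fuel) n≤)
      where
      fresh : ∀ a → a ≤ suc k → ¬ (p a ≡ w)
      fresh a a≤ e = unvisited (fromℕ< (s≤s a≤) , trans (cong p (toℕ-fromℕ< (s≤s a≤))) e)

    low-degree-vertex : Fin n → Σ (Fin n) (AtMostOneNeighbour G)
    low-degree-vertex x with any? (λ w → adj G x w ≟ᴮ true)
    ... | no none = x , λ w _ aw _ → ⊥-elim (none (w , aw))
    ... | yes (w , aw) = grow n 0 p edge-path (m≤n+m n 1)
      where
      p : ℕ → Fin n
      p zero = x
      p (suc _) = w
      x≢w : ¬ (x ≡ w)
      x≢w e = true≢false (subst (λ z → adj G x z ≡ true) (sym e) aw) (adj-irr G x)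
      edge-path : IsPath G p 1
      edge-path = record { distinct = distinct ; linked = λ { zero _ → aw ; (suc a) (s≤s ()) } }
        where
        distinct : ∀ {a b} → a ≤ 1 → b ≤ 1 → p a ≡ p b → a ≡ b
        distinct {zero} {zero} _ _ _ = refl
        distinct {zero} {suc zero} _ _ e = ⊥-elim (x≢w e)
        distinct {suc zero} {zero} _ _ e = ⊥-elim (x≢w (sym e))
        distinct {suc zero} {suc zero} _ _ _ = refl
        distinct {suc (suc _)} (s≤s ()) _ _
        distinct {_} {suc (suc _)} _ (s≤s ()) _

isolated-or-leaf : ∀ {n} (G : Graph (suc n)) → ¬ HasCycle G →
  (Σ (Fin (suc n)) λ v → ∀ w → adj G v w ≡ false) ⊎ (Σ (Fin (suc n)) λ v → Σ (Fin n) λ u → IsLeaf G v u)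
isolated-or-leaf G acyclic with low-degree-vertex {G = G} acyclic zero
... | v , one with any? (λ w → adj G v w ≟ᴮ true)
... | no none = inj₁ (v , λ w → ¬true⇒false (λ aw → none (w , aw)))
... | yes (w , aw) with punchIn-cover v w
... | inj₁ refl = ⊥-elim (true≢false aw (adj-irr G v))
... | inj₂ (u , refl) = inj₂ (v , u , record { edge = aw ; only = λ w′ aw′ → one w′ (punchIn v u) aw′ aw })

-- The forest bound.

-- pathCount n will be xhom(P n, E₂): 1, 0, 2, 2, 4, 6, 10, … .
pathCount : ℕ → ℕ
pathCount 0 = 1
pathCount 1 = 0
pathCount 2 = 2
pathCount (suc (suc (suc n))) = pathCount (suc (suc n)) + pathCount (suc n)

pathCount-step : ∀ n → pathCount (suc n) + pathCount n ≤ pathCount (suc (suc n))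
pathCount-step zero = s≤s z≤n
pathCount-step (suc n) = ≤-refl

pathCount-mono : ∀ m → pathCount (suc (suc m)) ≤ pathCount (suc (suc (suc m)))
pathCount-mono m = m≤m+n _ _

pathCount-double : ∀ n → pathCount n + pathCount n ≤ pathCount (suc (suc n))
pathCount-double zero = ≤-refl
pathCount-double (suc zero) = z≤n
pathCount-double (suc (suc m)) = +-mono-≤ (pathCount-mono m) ≤-refl

pathCount-nonzero : ∀ m → ¬ (pathCount (suc (suc m)) ≡ 0)
pathCount-nonzero zero ()
pathCount-nonzero (suc m) e = pathCount-nonzero m (m+n≡0⇒m≡0 (pathCount (suc (suc m))) e)

acyclic-∖ : ∀ {n} (G : Graph (suc n)) v → ¬ HasCycle G → ¬ HasCycle (G ∖ v)
acyclic-∖ G v acyclic (m , f , f-injective , linked , closed) =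
  acyclic (m , (λ j → punchIn v (f j)) , (λ e → f-injective (punchIn-injective v _ _ e)) , linked , closed)

isolated-or-neighbour : ∀ {m} (G : Graph (suc m)) x →
  (∀ w → adj G x w ≡ false) ⊎ (Σ (Fin m) λ w₀ → adj G x (punchIn x w₀) ≡ true)
isolated-or-neighbour G x with any? (λ w → adj G x w ≟ᴮ true)
... | no none = inj₁ (λ w → ¬true⇒false (λ aw → none (w , aw)))
... | yes (w , aw) with punchIn-cover x w
... | inj₁ refl = ⊥-elim (true≢false aw (adj-irr G x))
... | inj₂ (w₀ , refl) = inj₂ (w₀ , aw)

-- Removing a leaf v with neighbour u: the colourings of G ∖ v contribute at most
-- pathCount (n - 1), the colourings deficient at u at most pathCount (n - 2)
-- (or, if u is isolated in G ∖ v, none of the former and twice the latter).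
leaf-step : ∀ m (G : Graph (suc (suc m))) v u → IsLeaf G v u →
  count (suc m) (isXhom₂ (G ∖ v)) ≤ pathCount (suc m) →
  count m (isXhom₂ ((G ∖ v) ∖ u)) ≤ pathCount m →
  count (suc (suc m)) (isXhom₂ G) ≤ pathCount (suc (suc m))
leaf-step m G v u leaf bound-G′ bound-rest =
  ≤-trans (≤-reflexive count-leaf) (by-neighbourhood-of-u (isolated-or-neighbour G′ u))
  where
  open LeafRemoval G v u leaf
  open Deficient G′ u using (deficient-bound; deficient-bound-edge)
  by-neighbourhood-of-u : (∀ w → adj G′ u w ≡ false) ⊎ (Σ (Fin m) λ w₀ → adj G′ u (punchIn u w₀) ≡ true) →
    count (suc m) (isXhom₂ G′) + count (suc m) (deficient? G′ u) ≤ pathCount (suc (suc m))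
  by-neighbourhood-of-u (inj₂ (w₀ , aw₀)) = ≤-trans
    (+-mono-≤ bound-G′ (≤-trans (deficient-bound-edge w₀ aw₀) bound-rest))
    (pathCount-step m)
  by-neighbourhood-of-u (inj₁ isolated) = ≤-trans
    (+-mono-≤ (≤-reflexive (count-none (suc m) (isolated-no-xhom G′ u isolated)))
              (≤-trans deficient-bound (+-mono-≤ bound-rest bound-rest)))
    (pathCount-double m)

ForestBound : ℕ → Set
ForestBound n = (G : Graph n) → ¬ HasCycle G → count n (isXhom₂ G) ≤ pathCount n

forest-step : ∀ m → ForestBound m → ForestBound (suc m) → ForestBound (suc (suc m))
forest-step m bound₀ bound₁ G acyclic with isolated-or-leaf G acyclic
... | inj₁ (v , isolated) = ≤-trans (≤-reflexive (count-none (suc (suc m)) (isolated-no-xhom G v isolated))) z≤n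
... | inj₂ (v , u , leaf) = leaf-step m G v u leaf
  (bound₁ (G ∖ v) (acyclic-∖ G v acyclic))
  (bound₀ ((G ∖ v) ∖ u) (acyclic-∖ (G ∖ v) u (acyclic-∖ G v acyclic)))

forest-bound : ∀ n → ForestBound n
forest-bound zero G _ = 𝟙≤1 (isXhom₂ G emptyColouring)
  where
  𝟙≤1 : ∀ b → 𝟙 b ≤ 1
  𝟙≤1 true = ≤-refl
  𝟙≤1 false = z≤n
forest-bound (suc zero) G _ =
  ≤-reflexive (count-none 1 (isolated-no-xhom G zero λ { zero → adj-irr G zero }))
forest-bound (suc (suc m)) = forest-step m (forest-bound m) (forest-bound (suc m))

-- Vertex 0 is a leaf of P (n + 2), and deleting it leaves P (n + 1).
P-end-leaf : ∀ n → IsLeaf (P (suc (suc n))) zero zero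
P-end-leaf n = record { edge = refl ; only = only }
  where
  only : ∀ w → adj (P (suc (suc n))) zero w ≡ true → w ≡ suc zero
  only (suc zero) _ = refl
  only zero ()
  only (suc (suc w)) ()

count-path : ∀ n → count n (isXhom₂ (P n)) ≡ pathCount n
count-path 0 = refl
count-path 1 = refl
count-path 2 = refl
count-path (suc (suc (suc n))) = begin
  count (3 + n) (isXhom₂ (P (3 + n)))
    ≡⟨ LeafRemoval.count-leaf (P (3 + n)) zero zero (P-end-leaf (suc n)) ⟩
  count (2 + n) (isXhom₂ (P (2 + n))) + count (2 + n) (deficient? (P (2 + n)) zero)
    ≡⟨ cong (count (2 + n) (isXhom₂ (P (2 + n))) +_) (Deficient.deficient-count-leaf (P (2 + n)) zero zero (P-end-leaf n)) ⟩
  count (2 + n) (isXhom₂ (P (2 + n))) + count (1 + n) (isXhom₂ (P (1 + n)))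
    ≡⟨ cong₂ _+_ (count-path (suc (suc n))) (count-path (suc n)) ⟩
  pathCount (3 + n) ∎
  where open ≡-Reasoning

-- Invariance under isomorphism.

Extensional : ∀ {n} → (Colouring n → Bool) → Set
Extensional {n} p = ∀ φ ψ → (∀ i → φ i ≡ ψ i) → p φ ≡ p ψ

-- Put
-- v = τ⁻¹ 0: branching on the colour of vertex 0 after relabelling is branching
-- on the colour of v before, and remove v τ relabels the remaining vertices.
count-perm : ∀ n (τ : Permutation′ n) (p : Colouring n → Bool) → Extensional p →
  count n (λ φ → p (λ i → φ (τ ⟨$⟩ʳ i))) ≡ count n p
count-perm zero τ p ext = cong 𝟙 (ext _ _ (λ ()))
count-perm (suc n) τ p ext = trans (cong₂ _+_ (branch c₀) (branch c₁)) (sym (count-at n v p))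
  where
  v = τ ⟨$⟩ˡ zero
  τ′ = remove v τ
  τv≡0 : τ ⟨$⟩ʳ v ≡ zero
  τv≡0 = inverseʳ τ
  relabel : ∀ c φ x → consF c φ (τ ⟨$⟩ʳ x) ≡ ins v c (λ j → φ (τ′ ⟨$⟩ʳ j)) x
  relabel c φ x with punchIn-cover v x
  ... | inj₁ refl = trans (cong (consF c φ) τv≡0) (sym (ins-here v c _))
  ... | inj₂ (a , refl) = trans
    (cong (consF c φ) (trans (sym (punchIn-punchOut _)) (cong (λ z → punchIn z (τ′ ⟨$⟩ʳ a)) τv≡0)))
    (sym (ins-punchIn v c _ a))
  branch : ∀ c → count n (λ φ → p (λ i → consF c φ (τ ⟨$⟩ʳ i))) ≡ count n (λ φ → p (ins v c φ))
  branch c = trans (count-cong n (λ φ → ext _ _ (relabel c φ)))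
    (count-perm n τ′ (λ φ → p (ins v c φ)) (λ φ ψ e → ext _ _ (ins-cong v c e)))

isXhom₂-extensional : ∀ {n} (G : Graph n) → Extensional (isXhom₂ G)
isXhom₂-extensional G φ ψ e = bool-ext (transport φ ψ e) (transport ψ φ (λ i → sym (e i)))
  where
  transport : ∀ φ ψ → (∀ i → φ i ≡ ψ i) → isXhom₂ G φ ≡ true → isXhom₂ G ψ ≡ true
  transport φ ψ e h = isXhom₂-complete G ψ λ a → let (w , aw , c) = isXhom₂-sound G φ h a in
    w , aw , trans (sym (e a)) (trans c (e w))

isXhom₂-iso : ∀ {n} (T H : Graph n) (σ : Permutation′ n) →
  (∀ u w → adj H (σ ⟨$⟩ʳ u) (σ ⟨$⟩ʳ w) ≡ adj T u w) →
  ∀ ψ → isXhom₂ T (λ i → ψ (σ ⟨$⟩ʳ i)) ≡ isXhom₂ H ψ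
isXhom₂-iso T H σ hσ ψ = bool-ext
  (λ h → isXhom₂-complete H ψ (λ a → forward a (isXhom₂-sound T _ h (σ ⟨$⟩ˡ a))))
  (λ h → isXhom₂-complete T _ (λ u → backward u (isXhom₂-sound H ψ h (σ ⟨$⟩ʳ u))))
  where
  forward : ∀ a → Satisfied T (λ i → ψ (σ ⟨$⟩ʳ i)) (σ ⟨$⟩ˡ a) → Satisfied H ψ a
  forward a (w , aw , e) = σ ⟨$⟩ʳ w ,
    subst (λ z → adj H z (σ ⟨$⟩ʳ w) ≡ true) (inverseʳ σ) (trans (hσ _ w) aw) ,
    subst (λ z → ψ z ≡ ψ (σ ⟨$⟩ʳ w)) (inverseʳ σ) e
  backward : ∀ u → Satisfied H ψ (σ ⟨$⟩ʳ u) → Satisfied T (λ i → ψ (σ ⟨$⟩ʳ i)) u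
  backward u (w , aw , e) = σ ⟨$⟩ˡ w ,
    trans (sym (hσ u _)) (subst (λ z → adj H (σ ⟨$⟩ʳ u) z ≡ true) (sym (inverseʳ σ)) aw) ,
    trans e (cong ψ (sym (inverseʳ σ)))

count-iso : ∀ {n} (T H : Graph n) → T ≅ H → count n (isXhom₂ T) ≡ count n (isXhom₂ H)
count-iso {n} T H (σ , hσ) =
  trans (sym (count-perm n σ (isXhom₂ T) (isXhom₂-extensional T))) (count-cong n (isXhom₂-iso T H σ hσ))

≡ᵇ-true⇒≡ : ∀ m n → (m ≡ᵇ n) ≡ true → m ≡ n
≡ᵇ-true⇒≡ m n h = ≡ᵇ⇒≡ m n (Equivalence.from T-≡ h)

≡⇒≡ᵇ-true : ∀ m n → m ≡ n → (m ≡ᵇ n) ≡ true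
≡⇒≡ᵇ-true m n e = Equivalence.to T-≡ (≡⇒≡ᵇ m n e)

P-adj⁻ : ∀ {k} (i j : Fin k) → adj (P k) i j ≡ true → (suc (toℕ i) ≡ toℕ j) ⊎ (suc (toℕ j) ≡ toℕ i)
P-adj⁻ i j h with ∨-elim {suc (toℕ i) ≡ᵇ toℕ j} h
... | inj₁ e = inj₁ (≡ᵇ-true⇒≡ _ _ e)
... | inj₂ e = inj₂ (≡ᵇ-true⇒≡ _ _ e)

P-adj⁺ : ∀ {k} (i j : Fin k) → (suc (toℕ i) ≡ toℕ j) ⊎ (suc (toℕ j) ≡ toℕ i) → adj (P k) i j ≡ true
P-adj⁺ i j (inj₁ e) = ∨-introˡ (≡⇒≡ᵇ-true _ _ e)
P-adj⁺ i j (inj₂ e) = ∨-introʳ {suc (toℕ i) ≡ᵇ toℕ j} (≡⇒≡ᵇ-true _ _ e)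

punchIn-last : ∀ {n} (j : Fin n) → punchIn (fromℕ n) j ≡ inject₁ j
punchIn-last zero = refl
punchIn-last (suc j) = cong suc (punchIn-last j)

-- Deleting the last vertex of P (suc n) leaves P n (deleting the first one
-- leaves P n by definition).
P-∖-last : ∀ {n} (i j : Fin n) → adj (P (suc n) ∖ fromℕ n) i j ≡ adj (P n) i j
P-∖-last i j rewrite punchIn-last i | punchIn-last j =
  cong₂ (λ a b → (suc a ≡ᵇ b) ∨ (suc b ≡ᵇ a)) (toℕ-inject₁ i) (toℕ-inject₁ j)

P-last-leaf : ∀ n → IsLeaf (P (suc (suc n))) (fromℕ (suc n)) (fromℕ n)
P-last-leaf n = record { edge = edge ; only = only }
  where
  stem-position : toℕ (punchIn (fromℕ (suc n)) (fromℕ n)) ≡ n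
  stem-position = trans (cong toℕ (punchIn-last (fromℕ n))) (trans (toℕ-inject₁ (fromℕ n)) (toℕ-fromℕ n))
  edge : adj (P (suc (suc n))) (fromℕ (suc n)) (punchIn (fromℕ (suc n)) (fromℕ n)) ≡ true
  edge = P-adj⁺ _ _ (inj₂ (trans (cong suc stem-position) (sym (toℕ-fromℕ (suc n)))))
  only : ∀ w → adj (P (suc (suc n))) (fromℕ (suc n)) w ≡ true → w ≡ punchIn (fromℕ (suc n)) (fromℕ n)
  only w h with P-adj⁻ (fromℕ (suc n)) w h
  ... | inj₁ e = ⊥-elim (1+n≰n (subst (λ z → suc z ≤ suc (suc n)) (trans (sym e) (cong suc (toℕ-fromℕ (suc n)))) (toℕ<n w)))
  ... | inj₂ e = toℕ-injective (trans (suc-injective (trans e (toℕ-fromℕ (suc n)))) (sym stem-position))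

P-second-neighbours : ∀ k (w : Fin (suc (suc (suc k)))) → adj (P (suc (suc (suc k)))) (suc zero) w ≡ true →
  (w ≡ zero) ⊎ (w ≡ suc (suc zero))
P-second-neighbours k zero _ = inj₁ refl
P-second-neighbours k (suc (suc zero)) _ = inj₂ refl
P-second-neighbours k (suc zero) ()
P-second-neighbours k (suc (suc (suc w))) ()

-- A vertex of P (suc m) with at most one neighbour is one of the two ends:
-- an inner vertex j has the two neighbours j - 1 and j + 1.
P-low-degree-end : ∀ m (j : Fin (suc m)) → AtMostOneNeighbour (P (suc m)) j → (j ≡ zero) ⊎ (j ≡ fromℕ m)
P-low-degree-end m zero _ = inj₁ refl
P-low-degree-end m (suc j) one with suc (toℕ j) ≟ℕ m
... | yes e = inj₂ (toℕ-injective (trans e (sym (toℕ-fromℕ m))))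
... | no j+1≢m = ⊥-elim (j≢j+2 (trans (sym (toℕ-fromℕ< j<m)) (trans (cong toℕ (one before after before-adj after-adj)) (toℕ-fromℕ< (s≤s j+2≤m)))))
  where
  j+2≤m : suc (suc (toℕ j)) ≤ m
  j+2≤m = ≤∧≢⇒< (toℕ≤pred[n] (suc j)) j+1≢m
  j<m : toℕ j < suc m
  j<m = s≤s (≤-trans (n≤1+n _) (≤-trans (n≤1+n _) j+2≤m))
  before after : Fin (suc m)
  before = fromℕ< j<m
  after = fromℕ< (s≤s j+2≤m)
  before-adj : adj (P (suc m)) (suc j) before ≡ true
  before-adj = P-adj⁺ (suc j) before (inj₂ (cong suc (toℕ-fromℕ< j<m)))
  after-adj : adj (P (suc m)) (suc j) after ≡ true
  after-adj = P-adj⁺ (suc j) after (inj₁ (sym (toℕ-fromℕ< (s≤s j+2≤m))))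
  j≢j+2 : ¬ (toℕ j ≡ suc (suc (toℕ j)))
  j≢j+2 e = <-irrefl e (n≤1+n _)

perm-injective : ∀ {n} (σ : Permutation′ n) {a b} → σ ⟨$⟩ʳ a ≡ σ ⟨$⟩ʳ b → a ≡ b
perm-injective σ {a} {b} e = trans (sym (inverseˡ σ)) (trans (cong (σ ⟨$⟩ˡ_) e) (inverseˡ σ))

extend-iso : ∀ {n} (G H : Graph (suc n)) v t u (σ : Permutation′ n) → IsLeaf G v u → IsLeaf H t (σ ⟨$⟩ʳ u) →
  (∀ a b → adj (H ∖ t) (σ ⟨$⟩ʳ a) (σ ⟨$⟩ʳ b) ≡ adj (G ∖ v) a b) → G ≅ H
extend-iso {n} G H v t u σ leafG leafH hσ = τ , iso
  where
  τ : Permutation′ (suc n)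
  τ = insert v t σ
  τv : τ ⟨$⟩ʳ v ≡ t
  τv with v ≟ v
  ... | yes _ = refl
  ... | no v≢v = ⊥-elim (v≢v refl)
  τp : ∀ a → τ ⟨$⟩ʳ punchIn v a ≡ punchIn t (σ ⟨$⟩ʳ a)
  τp = insert-punchIn v t σ
  leaf-edges : ∀ b → adj H t (punchIn t (σ ⟨$⟩ʳ b)) ≡ adj G v (punchIn v b)
  leaf-edges b = bool-ext
    (λ h → subst (λ z → adj G v (punchIn v z) ≡ true)
                 (sym (perm-injective σ (punchIn-injective t _ _ (IsLeaf.only leafH _ h)))) (IsLeaf.edge leafG))
    (λ h → subst (λ z → adj H t (punchIn t (σ ⟨$⟩ʳ z)) ≡ true)
                 (sym (punchIn-injective v b u (IsLeaf.only leafG _ h))) (IsLeaf.edge leafH))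
  iso : ∀ x y → adj H (τ ⟨$⟩ʳ x) (τ ⟨$⟩ʳ y) ≡ adj G x y
  iso x y with punchIn-cover v x | punchIn-cover v y
  ... | inj₁ refl | inj₁ refl = trans (cong (λ z → adj H z z) τv) (trans (adj-irr H t) (sym (adj-irr G v)))
  ... | inj₁ refl | inj₂ (b , refl) = trans (cong₂ (adj H) τv (τp b)) (leaf-edges b)
  ... | inj₂ (a , refl) | inj₁ refl =
    trans (cong₂ (adj H) (τp a) τv) (trans (adj-sym H _ t) (trans (leaf-edges a) (adj-sym G v _)))
  ... | inj₂ (a , refl) | inj₂ (b , refl) = trans (cong₂ (adj H) (τp a) (τp b)) (hσ a b)

iso-one-neighbour : ∀ {n} {G H : Graph n} → ((σ , _) : G ≅ H) → ∀ x →
  AtMostOneNeighbour G x → AtMostOneNeighbour H (σ ⟨$⟩ʳ x)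
iso-one-neighbour {G = G} {H} (σ , hσ) x one w w′ aw aw′ =
  trans (sym (inverseʳ σ)) (trans (cong (σ ⟨$⟩ʳ_) (one _ _ (pull w aw) (pull w′ aw′))) (inverseʳ σ))
  where
  pull : ∀ w → adj H (σ ⟨$⟩ʳ x) w ≡ true → adj G x (σ ⟨$⟩ˡ w) ≡ true
  pull w h = trans (sym (hσ x _)) (subst (λ z → adj H (σ ⟨$⟩ʳ x) z ≡ true) (sym (inverseʳ σ)) h)

-- Deleting a leaf keeps a graph connected: a walk through the leaf v enters
-- and leaves it via the stem, so that detour can be cut out.
module _ {n} (T : Graph (suc n)) (v : Fin (suc n)) (u : Fin n) (leaf : IsLeaf T v u) where

  walk-∖-leaf : ∀ {x y} → Walk T x y → ∀ a b → punchIn v a ≡ x → punchIn v b ≡ y → Walk (T ∖ v) a b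
  walk-∖-leaf here a b refl eb = subst (Walk (T ∖ v) a) (punchIn-injective v a b (sym eb)) here
  walk-∖-leaf (step {w = w} xw W) a b refl eb with punchIn-cover v w
  ... | inj₂ (c , refl) = step xw (walk-∖-leaf W c b refl eb)
  walk-∖-leaf (step xw here) a b refl eb | inj₁ refl = ⊥-elim (punchInᵢ≢i v b eb)
  walk-∖-leaf (step xw (step vw W)) a b refl eb | inj₁ refl =
    subst (λ z → Walk (T ∖ v) z b) (sym (stem-only leaf a xw)) (walk-∖-leaf W u b (sym (IsLeaf.only leaf _ vw)) eb)

  tree-∖-leaf : IsTree T → IsTree (T ∖ v)
  tree-∖-leaf (connected , acyclic) =
    (λ a b → walk-∖-leaf (connected (punchIn v a) (punchIn v b)) a b refl refl) , acyclic-∖ T v acyclic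

walk-first-edge : ∀ {n} {G : Graph n} {x y} → Walk G x y → ¬ (x ≡ y) → Σ (Fin n) λ w → adj G x w ≡ true
walk-first-edge here x≢y = ⊥-elim (x≢y refl)
walk-first-edge (step xw _) _ = _ , xw

connected-neighbour : ∀ {k} (G : Graph (suc (suc k))) → Connected G → ∀ x → Σ (Fin (suc (suc k))) λ w → adj G x w ≡ true
connected-neighbour G connected zero = walk-first-edge (connected zero (suc zero)) (λ ())
connected-neighbour G connected (suc x) = walk-first-edge (connected (suc x) zero) (λ ())

-- The equality case.

+-squeeze : ∀ {a b c d} → a ≤ c → b ≤ d → a + b ≡ c + d → (a ≡ c) × (b ≡ d)
+-squeeze {a} {b} {c} {d} a≤c b≤d e = a≡c , +-cancelˡ-≡ a b d (trans e (cong (_+ d) (sym a≡c)))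
  where
  a≡c : a ≡ c
  a≡c = ≤-antisym a≤c (+-cancelʳ-≤ d c a (≤-trans (≤-reflexive (sym e)) (+-monoʳ-≤ a b≤d)))

Extremal : ∀ {n} → Graph n → Set
Extremal {n} T = count n (isXhom₂ T) ≡ pathCount n

PathIfExtremal : ℕ → Set
PathIfExtremal n = (T : Graph n) → IsTree T → Extremal T → T ≅ P n

small-tree-is-path : ∀ n → n ≤ 2 → (T : Graph n) → IsTree T → T ≅ P n
small-tree-is-path zero _ T _ = id , λ ()
small-tree-is-path (suc zero) _ T _ = id , λ { zero zero → sym (adj-irr T zero) }
small-tree-is-path (suc (suc zero)) _ T (connected , _) = id , same-edges
  where
  edge : adj T zero (suc zero) ≡ true
  edge with connected-neighbour T connected zero
  ... | zero , h = ⊥-elim (true≢false h (adj-irr T zero))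
  ... | suc zero , h = h
  same-edges : ∀ x y → adj (P 2) (id ⟨$⟩ʳ x) (id ⟨$⟩ʳ y) ≡ adj T x y
  same-edges zero zero = sym (adj-irr T zero)
  same-edges zero (suc zero) = sym edge
  same-edges (suc zero) zero = sym (trans (adj-sym T (suc zero) zero) edge)
  same-edges (suc zero) (suc zero) = sym (adj-irr T (suc zero))
small-tree-is-path (suc (suc (suc _))) (s≤s (s≤s ())) _ _

module ExtremalStep (m : ℕ) (IH : PathIfExtremal (suc (suc m))) (T : Graph (suc (suc (suc m))))
  (tree : IsTree T) (extremal : Extremal T) where

  -- Deleting a leaf v with stem u leaves an extremal tree, hence a path, and
  -- the colourings deficient at u attain their bound pathCount (m + 1).
  -- (Abstract: only the statement is used later, and unfolding the proof is costly.)
  abstract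
    leaf-removal : ∀ v u → IsLeaf T v u →
      (T ∖ v ≅ P (suc (suc m))) × (count (suc (suc m)) (deficient? (T ∖ v) u) ≡ pathCount (suc m))
    leaf-removal v u leaf = IH G′ tree′ (proj₁ tight) , proj₂ tight
      where
      open LeafRemoval T v u leaf
      tree′ : IsTree G′
      tree′ = tree-∖-leaf T v u leaf tree
      deficient-le : count (suc (suc m)) (deficient? G′ u) ≤ pathCount (suc m)
      deficient-le with isolated-or-neighbour G′ u
      ... | inj₁ isolated = let (w , aw) = connected-neighbour G′ (proj₁ tree′) u in ⊥-elim (true≢false aw (isolated w))
      ... | inj₂ (w₀ , aw₀) = ≤-trans (Deficient.deficient-bound-edge G′ u w₀ aw₀)
                                      (forest-bound (suc m) (G′ ∖ u) (acyclic-∖ G′ u (proj₂ tree′)))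
      tight : (count (suc (suc m)) (isXhom₂ G′) ≡ pathCount (suc (suc m))) × (count (suc (suc m)) (deficient? G′ u) ≡ pathCount (suc m))
      tight = +-squeeze (forest-bound (suc (suc m)) G′ (proj₂ tree′)) deficient-le (trans (sym count-leaf) extremal)

  rest-is-path : ∀ v u → IsLeaf T v u → T ∖ v ≅ P (suc (suc m))
  rest-is-path v u leaf = proj₁ (leaf-removal v u leaf)

  attach-at-end : ∀ v u (leaf : IsLeaf T v u) → let σ = proj₁ (rest-is-path v u leaf) in
    (σ ⟨$⟩ʳ u ≡ zero) ⊎ (σ ⟨$⟩ʳ u ≡ fromℕ (suc m)) → T ≅ P (suc (suc (suc m)))
  attach-at-end v u leaf (inj₁ σu≡0) =
    extend-iso T (P _) v zero u σ leaf (subst (IsLeaf (P _) zero) (sym σu≡0) (P-end-leaf (suc m))) hσ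
    where open Σ (rest-is-path v u leaf) renaming (proj₁ to σ; proj₂ to hσ)
  attach-at-end v u leaf (inj₂ σu≡last) =
    extend-iso T (P _) v (fromℕ (suc (suc m))) u σ leaf
               (subst (IsLeaf (P _) (fromℕ (suc (suc m)))) (sym σu≡last) (P-last-leaf (suc m)))
               (λ a b → trans (P-∖-last (σ ⟨$⟩ʳ a) (σ ⟨$⟩ʳ b)) (hσ a b))
    where open Σ (rest-is-path v u leaf) renaming (proj₁ to σ; proj₂ to hσ)

  attach-via-stem-degree : ∀ v u → IsLeaf T v u → AtMostOneNeighbour (T ∖ v) u → T ≅ P (suc (suc (suc m)))
  attach-via-stem-degree v u leaf one = attach-at-end v u leaf
    (P-low-degree-end (suc m) _ (iso-one-neighbour {G = T ∖ v} {H = P (suc (suc m))} (rest-is-path v u leaf) u one))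

-- The stem u of the leaf v sits away from the first vertex of the path
-- T ∖ v ≅ P (m + 3). The first vertex a₀ of that path is then a leaf of T as
-- well, with stem a₁. If a₁ were u, no colouring would be deficient at u,
-- against leaf-removal; so a₁ ≠ u, and after deleting a₀ the vertex a₁ keeps
-- its single neighbour a₂, whence attach-via-stem-degree applies to a₀.
module InnerStem (m : ℕ) (IH : PathIfExtremal (suc (suc (suc m)))) (T : Graph (suc (suc (suc (suc m)))))
  (tree : IsTree T) (extremal : Extremal T)
  (v : Fin (suc (suc (suc (suc m))))) (u : Fin (suc (suc (suc m)))) (leaf : IsLeaf T v u) where

  open ExtremalStep (suc m) IH T tree extremal

  G′ : Graph (suc (suc (suc m)))
  G′ = T ∖ v
  open Σ (rest-is-path v u leaf) renaming (proj₁ to σ; proj₂ to hσ)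

  a₀ a₁ a₂ : Fin (suc (suc (suc m)))
  a₀ = σ ⟨$⟩ˡ zero
  a₁ = σ ⟨$⟩ˡ suc zero
  a₂ = σ ⟨$⟩ˡ suc (suc zero)

  to-path : ∀ c d → adj G′ c d ≡ true → adj (P _) (σ ⟨$⟩ʳ c) (σ ⟨$⟩ʳ d) ≡ true
  to-path c d h = trans (hσ c d) h

  from-path : ∀ p d → σ ⟨$⟩ʳ d ≡ p → d ≡ σ ⟨$⟩ˡ p
  from-path p d e = trans (sym (inverseˡ σ)) (cong (σ ⟨$⟩ˡ_) e)

  a₀-a₁ : adj G′ a₀ a₁ ≡ true
  a₀-a₁ = trans (sym (hσ a₀ a₁)) (cong₂ (adj (P _)) (inverseʳ σ) (inverseʳ σ))

  a₀-only : ∀ d → adj G′ a₀ d ≡ true → d ≡ a₁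
  a₀-only d h = from-path (suc zero) d
    (IsLeaf.only (P-end-leaf (suc m)) _ (subst (λ z → adj (P _) z (σ ⟨$⟩ʳ d) ≡ true) (inverseʳ σ) (to-path a₀ d h)))

  a₁-only : ∀ d → adj G′ a₁ d ≡ true → (d ≡ a₀) ⊎ (d ≡ a₂)
  a₁-only d h with P-second-neighbours m _ (subst (λ z → adj (P _) z (σ ⟨$⟩ʳ d) ≡ true) (inverseʳ σ) (to-path a₁ d h))
  ... | inj₁ e = inj₁ (from-path zero d e)
  ... | inj₂ e = inj₂ (from-path (suc (suc zero)) d e)

  a₀≢u : ¬ (σ ⟨$⟩ʳ u ≡ zero) → ¬ (a₀ ≡ u)
  a₀≢u σu≢0 e = σu≢0 (trans (cong (σ ⟨$⟩ʳ_) (sym e)) (inverseʳ σ))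

  result : ¬ (σ ⟨$⟩ʳ u ≡ zero) → T ≅ P (suc (suc (suc (suc m))))
  result σu≢0 with a₁ ≟ u
  ... | yes a₁≡u = ⊥-elim (pathCount-nonzero m (trans (sym (proj₂ (leaf-removal v u leaf)))
          (count-none _ (pendant-no-deficient G′ u a₀ (a₀≢u σu≢0) (subst (λ z → adj G′ a₀ z ≡ true) a₁≡u a₀-a₁)
                                               (λ w h → trans (a₀-only w h) a₁≡u)))))
  ... | no a₁≢u = attach-via-stem-degree v′ x leaf′ one
    where
    v′ s : Fin (suc (suc (suc (suc m))))
    v′ = punchIn v a₀
    s = punchIn v a₁
    -- a₀ ≠ a₁, since σ sends them to 0 and 1
    v′≢s : ¬ (v′ ≡ s)
    v′≢s e with trans (sym (inverseʳ σ)) (trans (cong (σ ⟨$⟩ʳ_) (punchIn-injective v a₀ a₁ e)) (inverseʳ σ))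
    ... | ()
    -- the stem s of v′, as a vertex of T ∖ v′
    x : Fin (suc (suc (suc m)))
    x = punchOut v′≢s
    x≡s : punchIn v′ x ≡ s
    x≡s = punchIn-punchOut v′≢s
    leaf′ : IsLeaf T v′ x
    leaf′ = record
      { edge = subst (λ y → adj T v′ y ≡ true) (sym x≡s) a₀-a₁
      ; only = λ w h → let (d , d≡w , ad) = off-leaf leaf a₀ w (a₀≢u σu≢0) h in
                       trans (sym d≡w) (trans (cong (punchIn v) (a₀-only d ad)) (sym x≡s)) }
    toward-a₂ : ∀ w → adj T s (punchIn v′ w) ≡ true → punchIn v′ w ≡ punchIn v a₂
    toward-a₂ w h with off-leaf leaf a₁ (punchIn v′ w) a₁≢u h
    ... | d , d≡w , ad with a₁-only d ad
    ... | inj₁ refl = ⊥-elim (punchInᵢ≢i v′ w (sym d≡w))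
    ... | inj₂ refl = sym d≡w
    one : AtMostOneNeighbour (T ∖ v′) x
    one w₁ w₂ h₁ h₂ = punchIn-injective v′ w₁ w₂ (trans (toward-a₂ w₁ (subst (λ y → adj T y (punchIn v′ w₁) ≡ true) x≡s h₁))
                                                     (sym (toward-a₂ w₂ (subst (λ y → adj T y (punchIn v′ w₂) ≡ true) x≡s h₂))))

-- With a leaf v at hand: the rest T ∖ v is a path, and the stem of v is its
-- first vertex, or (when m = 0) its last vertex, or in the situation of InnerStem.
extremal-with-leaf : ∀ m → PathIfExtremal (suc (suc m)) → (T : Graph (suc (suc (suc m)))) → IsTree T → Extremal T →
  ∀ v u → IsLeaf T v u → T ≅ P (suc (suc (suc m)))
extremal-with-leaf m IH T tree extremal v u leaf
  with proj₁ (ExtremalStep.rest-is-path m IH T tree extremal v u leaf) ⟨$⟩ʳ u ≟ zero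
... | yes σu≡0 = ExtremalStep.attach-at-end m IH T tree extremal v u leaf (inj₁ σu≡0)
extremal-with-leaf zero IH T tree extremal v u leaf | no σu≢0 =
  ExtremalStep.attach-at-end zero IH T tree extremal v u leaf (inj₂ (last σu≢0))
  where
  last : ∀ {x : Fin 2} → ¬ (x ≡ zero) → x ≡ fromℕ 1
  last {zero} x≢0 = ⊥-elim (x≢0 refl)
  last {suc zero} _ = refl
extremal-with-leaf (suc m) IH T tree extremal v u leaf | no σu≢0 = InnerStem.result m IH T tree extremal v u leaf σu≢0

extremal-step : ∀ m → PathIfExtremal (suc (suc m)) → PathIfExtremal (suc (suc (suc m)))
extremal-step m IH T tree extremal with isolated-or-leaf T (proj₂ tree)
... | inj₁ (v , isolated) =
  ⊥-elim (pathCount-nonzero (suc m) (trans (sym extremal) (count-none _ (isolated-no-xhom T v isolated))))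
... | inj₂ (v , u , leaf) = extremal-with-leaf m IH T tree extremal v u leaf

extremal-is-path : ∀ n → PathIfExtremal n
extremal-is-path zero T tree _ = small-tree-is-path 0 z≤n T tree
extremal-is-path (suc zero) T tree _ = small-tree-is-path 1 (s≤s z≤n) T tree
extremal-is-path (suc (suc zero)) T tree _ = small-tree-is-path 2 ≤-refl T tree
extremal-is-path (suc (suc (suc m))) = extremal-step m (extremal-is-path (suc (suc m)))

mainTheorem6 : (n : ℕ) (T : Graph n) → IsTree T →
    (xhom T E₂ ≤ xhom (P n) E₂) × ((xhom T E₂ ≡ xhom (P n) E₂) ⇔ (T ≅ P n))
mainTheorem6 n T tree = bound , mk⇔ extremal⇒path path⇒extremal
  where
  count-T : xhom T E₂ ≡ count n (isXhom₂ T)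
  count-T = xhom≡count T
  count-P : xhom (P n) E₂ ≡ pathCount n
  count-P = trans (xhom≡count (P n)) (count-path n)
  bound : xhom T E₂ ≤ xhom (P n) E₂
  bound = subst₂ _≤_ (sym count-T) (sym count-P) (forest-bound n T (proj₂ tree))
  extremal⇒path : xhom T E₂ ≡ xhom (P n) E₂ → T ≅ P n
  extremal⇒path e = extremal-is-path n T tree (trans (sym count-T) (trans e count-P))
  path⇒extremal : T ≅ P n → xhom T E₂ ≡ xhom (P n) E₂
  path⇒extremal T≅P = trans count-T (trans (count-iso T (P n) T≅P) (sym (xhom≡count (P n))))
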